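{- Let $\Phi$ be a set of formulas each of the form $\Diamond^m p\to\Diamond^n p$ with $n>m>1$. Let $f_i:(W_i,R_i,r_i)\to(W,R,r)$ be a pointed p-morphism, where $(W_i,R_i)$ is a Kripke frame rooted at $r_i$ and $(W,R)$ is a $\mathbf{K}\oplus\Phi$ frame rooted at $r$. If $w,v\in W_i$ with $wR_iv$, then for any $u\notin W_i$, setting $W_{i+1}=W_i\cup\{u\}$ and $R_{i+1}=R_i\cup\{(w,u)\}\cup\{(u,c)\mid vR_ic\}$, the map $f_{i+1}:(W_{i+1},R_{i+1},r_i)\to(W,R,r)$ with $f_{i+1}(y)=f_i(y)$ for $y\in W_i$ and $f_{i+1}(u)=f_i(v)$ is a pointed p-morphism, and $\mathrm{d}_{i+1}(u)=\mathrm{d}_{i+1}(w)+1$ and $\mathrm{d}_{i+1}(y)=\mathrm{d}_i(y)$ for all $y\in W_i$.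
   Context: $R^0$ is the identity and $R^{k+1}=R^k\circ R$. A frame $(W,R)$ is rooted at $r$ if every point is reachable from $r$ via some $R^k$. A $\mathbf{K}\oplus\Phi$ frame satisfies $\forall x,y\,(xR^my\to xR^ny)$ for each $\Diamond^mp\to\Diamond^np\in\Phi$. A pointed p-morphism $f:(W',R',r')\to(W,R,r)$ is a map with $f(r')=r$, $xR'y\Rightarrow f(x)Rf(y)$, and if $f(x)Ry'$ then there is $y$ with $xR'y$ and $f(y)=y'$. $\mathrm{d}_{i+1}(y)$ is the length of a shortest path from $r_i$ to $y$ in $(W_{i+1},R_{i+1})$, and $\mathrm{d}_i(y)$ the length of a shortest path from $r_i$ to $y$ in $(W_i,R_i)$. -}

module Defs where

open import Data.Nat using (ℕ; zero; suc; _<_)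
open import Data.Product using (Σ; ∃; _×_; _,_)
open import Data.Maybe using (Maybe; just; nothing)
open import Relation.Nullary using (¬_)
open import Relation.Binary.PropositionalEquality using (_≡_)

Rel : Set → Set₁
Rel W = W → W → Set

Pow : {W : Set} → Rel W → ℕ → Rel W
Pow R zero    x y = x ≡ y
Pow R (suc k) x y = ∃ λ z → Pow R k x z × R z y

Rooted : {W : Set} → Rel W → W → Set
Rooted R r = ∀ y → ∃ λ k → Pow R k r y

-- Φ is given as a set of pairs (m , n), each standing for ◇^m p → ◇^n p.
-- (W,R) is a K ⊕ Φ frame.
KΦFrame : (Φ : ℕ → ℕ → Set) → {W : Set} → Rel W → Set
KΦFrame Φ R = ∀ m n → Φ m n → ∀ x y → Pow R m x y → Pow R n x y

record PMorphism {W' W : Set} (R' : Rel W') (r' : W') (R : Rel W) (r : W)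
                 (f : W' → W) : Set where
  field
    root  : f r' ≡ r
    forth : ∀ x y → R' x y → R (f x) (f y)
    back  : ∀ x y' → R (f x) y' → ∃ λ y → R' x y × f y ≡ y'

IsDist : {W : Set} → Rel W → W → W → ℕ → Set
IsDist R r y n = Pow R n r y × (∀ k → k < n → ¬ Pow R k r y)

-- The extended frame: W_{i+1} = W_i ∪ {u}, modelled as Maybe W_i with
-- u = nothing (a fresh point) and y ∈ W_i embedded as just y.
-- R_{i+1} = R_i ∪ {(w,u)} ∪ {(u,c) | v R_i c}.
data Ext {Wi : Set} (Ri : Rel Wi) (w v : Wi) : Rel (Maybe Wi) where
  old   : ∀ {x y} → Ri x y → Ext Ri w v (just x) (just y)
  toU   : Ext Ri w v (just w) nothing
  fromU : ∀ {c} → Ri v c → Ext Ri w v nothing (just c)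

extMap : {Wi W : Set} → (Wi → W) → Wi → Maybe Wi → W
extMap f v (just y) = f y
extMap f v nothing  = f v

{-# OPTIONS --safe #-}
module Submission where

-- Sending the fresh point u to v turns every path of the extended frame that
-- starts in W_i into a path of R_i of the same length: the edge w → u becomes
-- w → v (which exists by hypothesis) and u → c becomes v → c.  Paths in the
-- other direction are just paths of R_i, and every path ending in u ends with
-- the edge w → u.  Distances from r_i are therefore unchanged on W_i and
-- d(u) = d(w) + 1, while f_{i+1} = f_i ∘ (u ↦ v) inherits forth and back from f_i.

open import Defs
open import Data.Nat using (ℕ; zero; suc; _<_; s≤s)
open import Data.Product using (_×_; _,_)
open import Data.Maybe using (just; nothing; fromMaybe)
open import Function using (_∘′_)
open import Function.Bundles using (_⇔_; mk⇔; Equivalence)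
open import Relation.Nullary using (¬_)
open import Relation.Binary.PropositionalEquality using (refl)

open Equivalence using (to; from)

Pow-map : {A B : Set} {R : Rel A} {S : Rel B} (f : A → B) →
          (∀ {x y} → R x y → S (f x) (f y)) →
          ∀ k {x y} → Pow R k x y → Pow S k (f x) (f y)
Pow-map f hom zero    refl         = refl
Pow-map f hom (suc k) (z , p , xy) = f z , Pow-map f hom k p , hom xy

IsDist-cong : {A B : Set} {R : Rel A} {S : Rel B} {r y : A} {s z : B} →
              (∀ k → Pow R k r y ⇔ Pow S k s z) →
              ∀ n → IsDist R r y n ⇔ IsDist S s z n
IsDist-cong paths n = mk⇔
  (λ (p , minimal) → to (paths n) p , λ k k<n q → minimal k k<n (from (paths k) q))
  (λ (p , minimal) → from (paths n) p , λ k k<n q → minimal k k<n (to (paths k) q))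

IsDist-suc : {A : Set} {R : Rel A} {r x y : A} →
             ¬ Pow R zero r y →
             (∀ k → Pow R (suc k) r y ⇔ Pow R k r x) →
             ∀ n → IsDist R r y (suc n) ⇔ IsDist R r x n
IsDist-suc {R = R} {r} {x} {y} y≢r paths n = mk⇔
  (λ (p , minimal) → to (paths n) p , λ k k<n q → minimal (suc k) (s≤s k<n) (from (paths k) q))
  (λ (p , minimal) → from (paths n) p , shorter minimal)
  where
  shorter : (∀ k → k < n → ¬ Pow R k r x) → ∀ k → k < suc n → ¬ Pow R k r y
  shorter minimal zero    _         = y≢r
  shorter minimal (suc k) (s≤s k<n) = minimal k k<n ∘′ to (paths k)

module _ {Wi : Set} {Ri : Rel Wi} {w v : Wi} (wv : Ri w v) where

  Ext-collapse : ∀ {x y} → Ext Ri w v x y → Ri (fromMaybe v x) (fromMaybe v y)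
  Ext-collapse (old xy)   = xy
  Ext-collapse toU        = wv
  Ext-collapse (fromU vc) = vc

  Pow-Ext⇔Pow : ∀ {a b} k → Pow (Ext Ri w v) k (just a) (just b) ⇔ Pow Ri k a b
  Pow-Ext⇔Pow k = mk⇔ (Pow-map (fromMaybe v) Ext-collapse k) (Pow-map just old k)

  extMap-isPMorphism : {W : Set} {R : Rel W} {ri : Wi} {r : W} {f : Wi → W} →
                       PMorphism Ri ri R r f →
                       PMorphism (Ext Ri w v) (just ri) R r (extMap f v)
  extMap-isPMorphism pm = record
    { root  = root
    ; forth = λ where
        _ _ (old xy)   → forth _ _ xy
        _ _ toU        → forth _ _ wv
        _ _ (fromU vc) → forth _ _ vc
    ; back  = λ where
        (just x) y' fxy' → let y , xy , fy≡y' = back x y' fxy' in just y , old xy , fy≡y'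
        nothing  y' fvy' → let y , vy , fy≡y' = back v y' fvy' in just y , fromU vy , fy≡y'
    }
    where open PMorphism pm

Pow-Ext-fresh⇔Pow-Ext : {Wi : Set} {Ri : Rel Wi} {w v a : Wi} →
                        ∀ k → Pow (Ext Ri w v) (suc k) (just a) nothing
                              ⇔ Pow (Ext Ri w v) k (just a) (just w)
Pow-Ext-fresh⇔Pow-Ext k = mk⇔ (λ { (_ , p , toU) → p }) (λ p → _ , p , toU)

mainTheorem6 :
    (Φ : ℕ → ℕ → Set) →
    (∀ m n → Φ m n → (1 < m) × (m < n)) →
    {Wi W : Set} (Ri : Rel Wi) (ri : Wi) (R : Rel W) (r : W) (fi : Wi → W) →
    Rooted Ri ri →
    KΦFrame Φ R → Rooted R r →
    PMorphism Ri ri R r fi →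
    (w v : Wi) → Ri w v →
    PMorphism (Ext Ri w v) (just ri) R r (extMap fi v)
    × (∀ n → IsDist (Ext Ri w v) (just ri) nothing (suc n)
             ⇔ IsDist (Ext Ri w v) (just ri) (just w) n)
    × (∀ (y : Wi) n → IsDist (Ext Ri w v) (just ri) (just y) n ⇔ IsDist Ri ri y n)
mainTheorem6 _ _ _ _ _ _ _ _ _ _ fi-pmorphism w v wv =
    extMap-isPMorphism wv fi-pmorphism
  , IsDist-suc (λ ()) Pow-Ext-fresh⇔Pow-Ext
  , λ y → IsDist-cong (Pow-Ext⇔Pow wv)
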